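{- The equation $N;(-1)=N$ (the standard normal generator followed by the scalar $-1$ equals the standard normal generator) is derivable in $\overrightarrow{\mathsf{GQA}}$.
   Context: $\overrightarrow{\mathsf{GQA}}$ is the prop (symmetric strict monoidal category with objects $\mathbb N$) freely generated by copy $\delta\colon1\to2$, discard $\epsilon\colon1\to0$, addition $\mu\colon2\to1$, zero $\eta\colon0\to1$, scalars $k\colon1\to1$ ($k\in\mathbb R$), one $\mathbf 1\colon0\to1$ and $N\colon0\to1$, modulo the equations: every equation between $N$-free diagrams having the same interpretation as affine maps (copy $x\mapsto(x,x)$, discard $x\mapsto()$, addition $(x_1,x_2)\mapsto x_1+x_2$, zero $()\mapsto0$, scalar $k$: $x\mapsto kx$, one $()\mapsto1$); (D) $N;\epsilon=\mathrm{id}_0$; (RI) for each $\varphi\in[0,2\pi)$, $(N\oplus N);R_\varphi=N\oplus N$, where $R_\varphi\colon2\to2$ is an $N$-free diagram interpreted as the matrix $\begin{pmatrix}\cos\varphi&-\sin\varphi\\ \sin\varphi&\cos\varphi\end{pmatrix}$. -}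

module Defs where

open import Level using (0ℓ)
open import Data.Nat as ℕ using (ℕ; zero; suc)
open import Data.Nat.Properties using (+-assoc; +-identityʳ)
open import Data.Fin using (Fin; splitAt; join; _≟_)
import Data.Fin as F
open import Data.Sum using (_⊎_; inj₁; inj₂)
import Data.Sum as Sum
open import Data.Product using (Σ; ∃; _×_; _,_)
open import Relation.Nullary using (¬_; yes; no)
open import Relation.Binary.PropositionalEquality using (_≡_; refl; sym; subst₂)
open import Algebra.Structures using (IsCommutativeRing)
open import Relation.Binary.Structures using (IsTotalOrder)

-- The real numbers, axiomatised as a complete ordered field
-- (any two such structures are isomorphic, so quantifying over all of
-- them is the same as speaking about ℝ).

record Reals : Set₁ where
  infixl 6 _+ʳ_
  infixl 7 _*ʳ_
  infix 4 _≈ʳ_ _≤ʳ_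
  field
    ℝ     : Set
    _≈ʳ_  : ℝ → ℝ → Set
    _+ʳ_  : ℝ → ℝ → ℝ
    _*ʳ_  : ℝ → ℝ → ℝ
    -ʳ_   : ℝ → ℝ
    0ʳ    : ℝ
    1ʳ    : ℝ
    isCommutativeRing : IsCommutativeRing _≈ʳ_ _+ʳ_ _*ʳ_ -ʳ_ 0ʳ 1ʳ
    0≉1   : ¬ (0ʳ ≈ʳ 1ʳ)
    inverse : ∀ x → ¬ (x ≈ʳ 0ʳ) → ∃ λ y → x *ʳ y ≈ʳ 1ʳ
    _≤ʳ_  : ℝ → ℝ → Set
    isTotalOrder : IsTotalOrder _≈ʳ_ _≤ʳ_
    +-mono : ∀ {x y} z → x ≤ʳ y → x +ʳ z ≤ʳ y +ʳ z
    *-nonneg : ∀ {x y} → 0ʳ ≤ʳ x → 0ʳ ≤ʳ y → 0ʳ ≤ʳ x *ʳ y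
    lub : (P : ℝ → Set) → (∃ λ x → P x) → (∃ λ b → ∀ x → P x → x ≤ʳ b) →
          ∃ λ s → (∀ x → P x → x ≤ʳ s) × (∀ b → (∀ x → P x → x ≤ʳ b) → s ≤ʳ b)

module GQA (R : Reals) where
  open Reals R

  infixl 5 _⨾_
  infixl 6 _⊕_
  infix 4 _≈ᴳ_ _≋_

  -- diagrams: terms of the free symmetric strict monoidal category
  data Tm : ℕ → ℕ → Set where
    id   : ∀ n → Tm n n
    swap : ∀ a b → Tm (a ℕ.+ b) (b ℕ.+ a)
    _⨾_  : ∀ {a b c} → Tm a b → Tm b c → Tm a c
    _⊕_  : ∀ {a b c d} → Tm a b → Tm c d → Tm (a ℕ.+ c) (b ℕ.+ d)
    δ    : Tm 1 2
    ε    : Tm 1 0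
    μ    : Tm 2 1
    η    : Tm 0 1
    sc   : ℝ → Tm 1 1
    one  : Tm 0 1
    N    : Tm 0 1          -- standard normal

  cast : ∀ {a a' b b'} → a ≡ a' → b ≡ b' → Tm a b → Tm a' b'
  cast p q t = subst₂ Tm p q t

  data NFree : ∀ {a b} → Tm a b → Set where
    id   : ∀ n → NFree (id n)
    swap : ∀ a b → NFree (swap a b)
    _⨾_  : ∀ {a b c} {f : Tm a b} {g : Tm b c} → NFree f → NFree g → NFree (f ⨾ g)
    _⊕_  : ∀ {a b c d} {f : Tm a b} {g : Tm c d} → NFree f → NFree g → NFree (f ⊕ g)
    δ    : NFree δ
    ε    : NFree ε
    μ    : NFree μ
    η    : NFree η
    sc   : ∀ k → NFree (sc k)
    one  : NFree one

  -- affine maps ℝ^a → ℝ^b : x ↦ M x + v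
  record Aff (a b : ℕ) : Set where
    constructor aff
    field
      mat : Fin b → Fin a → ℝ
      vec : Fin b → ℝ
  open Aff

  _≋_ : ∀ {a b} → Aff a b → Aff a b → Set
  f ≋ g = (∀ i j → mat f i j ≈ʳ mat g i j) × (∀ i → vec f i ≈ʳ vec g i)

  ∑ : ∀ n → (Fin n → ℝ) → ℝ
  ∑ zero    f = 0ʳ
  ∑ (suc n) f = f F.zero +ʳ ∑ n (λ i → f (F.suc i))

  δᶠ : ∀ {n} → Fin n → Fin n → ℝ
  δᶠ i j with i ≟ j
  ... | yes _ = 1ʳ
  ... | no  _ = 0ʳ

  idA : ∀ n → Aff n n
  idA n = aff δᶠ (λ _ → 0ʳ)

  swapA : ∀ a b → Aff (a ℕ.+ b) (b ℕ.+ a)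
  swapA a b = aff (λ i j → δᶠ (join a b (Sum.swap (splitAt b i))) j) (λ _ → 0ʳ)

  _∘A_ : ∀ {a b c} → Aff b c → Aff a b → Aff a c
  _∘A_ {b = b} g f =
    aff (λ i k → ∑ b (λ j → mat g i j *ʳ mat f j k))
        (λ i → ∑ b (λ j → mat g i j *ʳ vec f j) +ʳ vec g i)

  _⊕A_ : ∀ {a b c d} → Aff a b → Aff c d → Aff (a ℕ.+ c) (b ℕ.+ d)
  _⊕A_ {a} {b} f g = aff m v
    where
      m : _ → _ → ℝ
      m i j with splitAt b i | splitAt a j
      ... | inj₁ i' | inj₁ j' = mat f i' j'
      ... | inj₂ i' | inj₂ j' = mat g i' j'
      ... | _       | _       = 0ʳ
      v : _ → ℝ
      v i with splitAt b i
      ... | inj₁ i' = vec f i'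
      ... | inj₂ i' = vec g i'

  ⟦_⟧ : ∀ {a b} {t : Tm a b} → NFree t → Aff a b
  ⟦ id n ⟧     = idA n
  ⟦ swap a b ⟧ = swapA a b
  ⟦ p ⨾ q ⟧    = ⟦ q ⟧ ∘A ⟦ p ⟧
  ⟦ p ⊕ q ⟧    = ⟦ p ⟧ ⊕A ⟦ q ⟧
  ⟦ δ ⟧        = aff (λ _ _ → 1ʳ) (λ _ → 0ʳ)
  ⟦ ε ⟧        = aff (λ ()) (λ ())
  ⟦ μ ⟧        = aff (λ _ _ → 1ʳ) (λ _ → 0ʳ)
  ⟦ η ⟧        = aff (λ _ ()) (λ _ → 0ʳ)
  ⟦ sc k ⟧     = aff (λ _ _ → k) (λ _ → 0ʳ)
  ⟦ one ⟧      = aff (λ _ ()) (λ _ → 1ʳ)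

  -- rotation matrix with cos φ = c, sin φ = s
  RotA : ℝ → ℝ → Aff 2 2
  RotA c s = aff m (λ _ → 0ʳ)
    where
      m : Fin 2 → Fin 2 → ℝ
      m F.zero    F.zero    = c
      m F.zero    (F.suc _) = -ʳ s
      m (F.suc _) F.zero    = s
      m (F.suc _) (F.suc _) = c

  data _≈ᴳ_ : ∀ {a b} → Tm a b → Tm a b → Set where
    ≈-refl  : ∀ {a b} {f : Tm a b} → f ≈ᴳ f
    ≈-sym   : ∀ {a b} {f g : Tm a b} → f ≈ᴳ g → g ≈ᴳ f
    ≈-trans : ∀ {a b} {f g h : Tm a b} → f ≈ᴳ g → g ≈ᴳ h → f ≈ᴳ h
    ⨾-cong : ∀ {a b c} {f f' : Tm a b} {g g' : Tm b c} →
             f ≈ᴳ f' → g ≈ᴳ g' → f ⨾ g ≈ᴳ f' ⨾ g'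
    ⊕-cong : ∀ {a b c d} {f f' : Tm a b} {g g' : Tm c d} →
             f ≈ᴳ f' → g ≈ᴳ g' → f ⊕ g ≈ᴳ f' ⊕ g'
    idˡ   : ∀ {a b} (f : Tm a b) → id a ⨾ f ≈ᴳ f
    idʳ   : ∀ {a b} (f : Tm a b) → f ⨾ id b ≈ᴳ f
    assoc : ∀ {a b c d} (f : Tm a b) (g : Tm b c) (h : Tm c d) →
            (f ⨾ g) ⨾ h ≈ᴳ f ⨾ (g ⨾ h)
    ⊕-id  : ∀ a b → id a ⊕ id b ≈ᴳ id (a ℕ.+ b)
    interchange : ∀ {a b c d e f} (f₁ : Tm a b) (g₁ : Tm b c) (f₂ : Tm d e) (g₂ : Tm e f) →
                  (f₁ ⨾ g₁) ⊕ (f₂ ⨾ g₂) ≈ᴳ (f₁ ⊕ f₂) ⨾ (g₁ ⊕ g₂)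
    ⊕-assoc : ∀ {a b c d e f} (f₁ : Tm a b) (f₂ : Tm c d) (f₃ : Tm e f) →
              cast (+-assoc a c e) (+-assoc b d f) ((f₁ ⊕ f₂) ⊕ f₃) ≈ᴳ f₁ ⊕ (f₂ ⊕ f₃)
    ⊕-unitˡ : ∀ {a b} (f : Tm a b) → id 0 ⊕ f ≈ᴳ f
    ⊕-unitʳ : ∀ {a b} (f : Tm a b) → cast (+-identityʳ a) (+-identityʳ b) (f ⊕ id 0) ≈ᴳ f
    swap-natural : ∀ {a b c d} (f : Tm a b) (g : Tm c d) →
                   swap a c ⨾ (g ⊕ f) ≈ᴳ (f ⊕ g) ⨾ swap b d
    swap-inv  : ∀ a b → swap a b ⨾ swap b a ≈ᴳ id (a ℕ.+ b)
    swap-unit : ∀ a → cast refl (+-identityʳ a) (swap 0 a) ≈ᴳ id a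
    swap-hexagon : ∀ a b c →
      cast (+-assoc a b c) (sym (+-assoc b c a))
           ((swap a b ⊕ id c) ⨾ cast (sym (+-assoc b a c)) refl (id b ⊕ swap a c))
        ≈ᴳ swap a (b ℕ.+ c)
    semantic : ∀ {a b} {f g : Tm a b} (p : NFree f) (q : NFree g) →
               ⟦ p ⟧ ≋ ⟦ q ⟧ → f ≈ᴳ g
    D  : N ⨾ ε ≈ᴳ id 0
    -- (RI): for every φ, (N ⊕ N) ; R_φ = N ⊕ N, where R_φ is an N-free diagram
    -- interpreted as the rotation matrix; (cos φ, sin φ) for φ ∈ [0,2π)
    -- ranges exactly over the pairs (c , s) with c² + s² = 1.
    RI : ∀ (c s : ℝ) → c *ʳ c +ʳ s *ʳ s ≈ʳ 1ʳ →
         ∀ (r : Tm 2 2) (p : NFree r) → ⟦ p ⟧ ≋ RotA c s →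
         (N ⊕ N) ⨾ r ≈ᴳ N ⊕ N

-- Pushing a pair of independent standard normals through the rotation by π
-- (which is the scalar -1 on each wire) leaves it unchanged by (RI); discarding
-- the second wire with (D) then isolates the first, so N ; (-1) = N.  The same
-- argument works for any scalar c with c² = 1.
module Submission where

open import Defs
open import Data.Product using (_,_)
import Data.Fin as F
open import Algebra.Bundles using (CommutativeRing)
import Algebra.Properties.Ring as RingProperties

module _ (R : Reals) where
  open Reals R
  open GQA R

  private
    ℝ-commutativeRing : CommutativeRing _ _
    ℝ-commutativeRing = record { isCommutativeRing = isCommutativeRing }

    open CommutativeRing ℝ-commutativeRing
      using (+-identityʳ; zeroˡ; +-cong; refl; sym; trans; ring)
    open RingProperties ring using (-0#≈0#; -1*x≈-x; -‿involutive)

  -1*-1≈1 : (-ʳ 1ʳ) *ʳ (-ʳ 1ʳ) ≈ʳ 1ʳ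
  -1*-1≈1 = trans (-1*x≈-x (-ʳ 1ʳ)) (-‿involutive 1ʳ)

  sc⨾ε≈ε : ∀ k → sc k ⨾ ε ≈ᴳ ε
  sc⨾ε≈ε k = semantic (sc k ⨾ ε) ε ((λ ()) , (λ ()))

  ⊕-projectˡ : ∀ {f g : Tm 0 1} → g ⨾ ε ≈ᴳ id 0 → (f ⊕ g) ⨾ (id 1 ⊕ ε) ≈ᴳ f
  ⊕-projectˡ {f} {g} g-discardable =
    ≈-trans (≈-sym (interchange f (id 1) g ε))
    (≈-trans (⊕-cong (idʳ f) g-discardable)
             (⊕-unitʳ f))

  -- The diagonal matrix diag(c, c) is the rotation with cos φ = c, sin φ = 0.
  N⊕N-reflection-invariant : ∀ {c} → c *ʳ c ≈ʳ 1ʳ → (N ⊕ N) ⨾ (sc c ⊕ sc c) ≈ᴳ N ⊕ N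
  N⊕N-reflection-invariant {c} c²≈1 =
    RI c 0ʳ c²+0²≈1 (sc c ⊕ sc c) (sc c ⊕ sc c) (same-matrix , same-vector)
    where
      c²+0²≈1 : c *ʳ c +ʳ 0ʳ *ʳ 0ʳ ≈ʳ 1ʳ
      c²+0²≈1 = trans (+-cong c²≈1 (zeroˡ 0ʳ)) (+-identityʳ 1ʳ)

      same-matrix : ∀ i j → Aff.mat ⟦ sc c ⊕ sc c ⟧ i j ≈ʳ Aff.mat (RotA c 0ʳ) i j
      same-matrix F.zero           F.zero           = refl
      same-matrix F.zero           (F.suc F.zero)   = sym -0#≈0#
      same-matrix (F.suc F.zero)   F.zero           = refl
      same-matrix (F.suc F.zero)   (F.suc F.zero)   = refl

      same-vector : ∀ i → Aff.vec ⟦ sc c ⊕ sc c ⟧ i ≈ʳ Aff.vec (RotA c 0ʳ) i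
      same-vector F.zero         = refl
      same-vector (F.suc F.zero) = refl

  N⨾sc-invariant : ∀ {c} → c *ʳ c ≈ʳ 1ʳ → N ⨾ sc c ≈ᴳ N
  N⨾sc-invariant {c} c²≈1 =
    ≈-trans (≈-sym (⊕-projectˡ Nc-discardable))
    (≈-trans (⨾-cong (interchange N (sc c) N (sc c)) ≈-refl)
    (≈-trans (⨾-cong (N⊕N-reflection-invariant c²≈1) ≈-refl)
             (⊕-projectˡ D)))
    where
      Nc-discardable : (N ⨾ sc c) ⨾ ε ≈ᴳ id 0
      Nc-discardable = ≈-trans (assoc N (sc c) ε) (≈-trans (⨾-cong ≈-refl (sc⨾ε≈ε c)) D)

proposition12 : (R : Reals) → let open Reals R in let open GQA R in
    N ⨾ sc (-ʳ 1ʳ) ≈ᴳ N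
proposition12 R = N⨾sc-invariant R (-1*-1≈1 R)
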